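{- Let $G=(V,E)$ be an equidominating graph with equidominating structure $(w,t)$ and let $x,y\in V$ be two vertices of different twin classes with $\mathrm{dist}(x,y)\ge 2$. Then $w(x)\ne w(y)$.
   Context: All graphs are finite, simple and undirected; $\mathbb{N}=\{1,2,\dots\}$. A minimal dominating set (mds) of $G=(V,E)$ is an inclusion-minimal set $D\subseteq V$ such that every vertex is in $D$ or adjacent to a vertex of $D$. An equidominating structure of $G$ is a pair $(w,t)$ with $t\in\mathbb{N}$, $w\colon V\to\mathbb{N}$, such that for all $D\subseteq V$: $D$ is an mds iff $\sum_{v\in D}w(v)=t$; $G$ is equidominating if such a structure exists. Two vertices $v,w$ are twins if $N(v)\setminus\{w\}=N(w)\setminus\{v\}$; this is an equivalence relation whose classes are the twin classes. $\mathrm{dist}(x,y)$ is the length of a shortest $x$–$y$ path (infinite if none exists). -}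

module Defs where

open import Data.Nat using (ℕ; zero; suc; _+_; _<_)
open import Data.Fin using (Fin)
open import Data.Fin.Subset using (Subset; _∈_; _⊂_; _⊆_)
open import Data.Vec using (Vec; []; _∷_)
open import Data.Bool using (true; false)
open import Data.Empty using (⊥)
open import Data.Product using (Σ; _×_; ∃)
open import Data.Sum using (_⊎_)
open import Relation.Nullary using (¬_)
open import Relation.Binary.PropositionalEquality using (_≡_; _≢_)
open import Level using (0ℓ)

record Graph (n : ℕ) : Set₁ where
  field
    Adj   : Fin n → Fin n → Set
    sym   : ∀ {u v} → Adj u v → Adj v u
    irrefl : ∀ {v} → ¬ Adj v v
open Graph public

Dominated : ∀ {n} → Graph n → Subset n → Fin n → Set
Dominated G D v = v ∈ D ⊎ Σ (Fin _) (λ u → u ∈ D × Adj G v u)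

Dominating : ∀ {n} → Graph n → Subset n → Set
Dominating G D = ∀ v → Dominated G D v

MinimalDominating : ∀ {n} → Graph n → Subset n → Set
MinimalDominating G D =
  Dominating G D × (∀ D′ → D′ ⊂ D → ¬ Dominating G D′)

weightSum : ∀ {n} → (Fin n → ℕ) → Subset n → ℕ
weightSum {zero}  w []            = 0
weightSum {suc n} w (true  ∷ D)   = w Fin.zero + weightSum (λ i → w (Fin.suc i)) D
weightSum {suc n} w (false ∷ D)   = weightSum (λ i → w (Fin.suc i)) D

-- Equidominating structure (w , t) with w : V → ℕ⁺ and t ∈ ℕ⁺ (ℕ = {1,2,...}).
record EquidominatingStructure {n} (G : Graph n) (w : Fin n → ℕ) (t : ℕ) : Set where
  field
    w-pos : ∀ v → 0 < w v
    t-pos : 0 < t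
    char  : ∀ D → (MinimalDominating G D → weightSum w D ≡ t)
                × (weightSum w D ≡ t → MinimalDominating G D)

Twins : ∀ {n} → Graph n → Fin n → Fin n → Set
Twins G u v = ∀ z → z ≢ u → z ≢ v → (Adj G u z → Adj G v z) × (Adj G v z → Adj G u z)

data Walk {n} (G : Graph n) : Fin n → Fin n → ℕ → Set where
  here : ∀ {x} → Walk G x x 0
  step : ∀ {x y z k} → Adj G x y → Walk G y z k → Walk G x z (suc k)

-- dist(x,y) ≥ k  (including dist = ∞): no walk from x to y of length < k.
DistGe : ∀ {n} → Graph n → Fin n → Fin n → ℕ → Set
DistGe G x y k = ∀ m → m < k → ¬ Walk G x y m

-- Let x, y be non-adjacent and not twins.
-- Then some vertex z is adjacent to one of them, say b, but not to the other,
-- say a.  Extend the independent set {a, z} to a maximal independent set S;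
-- S is a minimal dominating set, so weightSum w S = t.  Since z ∈ S is
-- adjacent to b, we have b ∉ S.  Exchanging a for b gives a set S′ of the
-- same weight when w a = w b, hence S′ would be a minimal dominating set;
-- but a is not dominated by S′ (b is not adjacent to a, and S is independent).
--
-- Steps (2)–(4) use decidable adjacency; since the theorem's conclusion is
-- a negation, decidability is obtained by a double-negation argument.

module Submission where

open import Defs
open import Data.Nat using (ℕ; zero; suc; _+_; _≤_; s≤s; z≤n)
open import Data.Nat.Properties using (≤-trans; ≤⇒≯; +-suc; +-monoʳ-≤; m≤m+n; +-assoc; +-comm)
open import Data.Fin using (Fin) renaming (zero to fzero; suc to fsuc)
open import Data.Fin.Properties using (any?; _≟_)
open import Data.Fin.Subset using (Subset; _∈_; _∉_; _⊆_; _⊂_; ∣_∣) renaming (⊥ to ∅)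
open import Data.Fin.Subset.Properties using (_∈?_; ∉⊥; p⊂q⇒∣p∣<∣q∣; ∣p∣≤n)
open import Data.Vec using (_∷_; here; there; lookup; _[_]≔_)
open import Data.Vec.Properties using ([]≔-updates; []≔-minimal; []≔-idempotent; []≔-lookup; []=⇒lookup; lookup⇒[]=; lookup∘update′; []=-injective)
open import Data.Bool using (Bool; true; false)
open import Data.Empty using (⊥; ⊥-elim)
open import Data.Product using (∃; _×_; _,_; proj₁; proj₂)
open import Data.Sum using (_⊎_; inj₁; inj₂)
open import Relation.Nullary using (¬_; Dec; yes; no)
open import Relation.Nullary.Decidable using (_×-dec_; _⊎-dec_; ¬?; ¬¬-excluded-middle)
open import Relation.Binary.PropositionalEquality using (_≡_; _≢_; refl; trans; cong; subst; module ≡-Reasoning) renaming (sym to ≡-sym)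

∈-insert : ∀ {n} (D : Subset n) (i : Fin n) → i ∈ D [ i ]≔ true
∈-insert D i = []≔-updates D i

∉-delete : ∀ {n} (D : Subset n) (i : Fin n) → i ∉ D [ i ]≔ false
∉-delete D i i∈ with []=-injective i∈ ([]≔-updates D i)
... | ()

∈-update⁺ : ∀ {n} (D : Subset n) {i j : Fin n} (b : Bool) → j ≢ i → j ∈ D → j ∈ D [ i ]≔ b
∈-update⁺ D {i} {j} b j≢i j∈D = []≔-minimal D j i j≢i j∈D

∈-update⁻ : ∀ {n} (D : Subset n) {i j : Fin n} (b : Bool) → j ≢ i → j ∈ D [ i ]≔ b → j ∈ D
∈-update⁻ D {i} {j} b j≢i j∈ =
  lookup⇒[]= j D (trans (≡-sym (lookup∘update′ j≢i D b)) ([]=⇒lookup j∈))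

∈-insert⁻ : ∀ {n} (D : Subset n) {i j : Fin n} → j ∈ D [ i ]≔ true → j ≡ i ⊎ j ∈ D
∈-insert⁻ D {i} {j} j∈ with j ≟ i
... | yes j≡i = inj₁ j≡i
... | no  j≢i = inj₂ (∈-update⁻ D true j≢i j∈)

⊂-insert : ∀ {n} (D : Subset n) {i : Fin n} → i ∉ D → D ⊂ D [ i ]≔ true
⊂-insert D {i} i∉D = ⊆-insert , i , ∈-insert D i , i∉D
  where
  ⊆-insert : D ⊆ D [ i ]≔ true
  ⊆-insert {j} j∈D with j ≟ i
  ... | yes refl = ∈-insert D i
  ... | no  j≢i  = ∈-update⁺ D true j≢i j∈D

pair : ∀ {n} → Fin n → Fin n → Subset n
pair a z = (∅ [ z ]≔ true) [ a ]≔ true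

pair-∋ˡ : ∀ {n} (a z : Fin n) → a ∈ pair a z
pair-∋ˡ a z = ∈-insert _ a

pair-∋ʳ : ∀ {n} (a z : Fin n) → z ∈ pair a z
pair-∋ʳ a z with z ≟ a
... | yes refl = ∈-insert _ a
... | no  z≢a  = ∈-update⁺ _ true z≢a (∈-insert ∅ z)

pair-members : ∀ {n} {a z u : Fin n} → u ∈ pair a z → u ≡ a ⊎ u ≡ z
pair-members {z = z} u∈ with ∈-insert⁻ (∅ [ z ]≔ true) u∈
... | inj₁ u≡a = inj₁ u≡a
... | inj₂ u∈z with ∈-insert⁻ ∅ u∈z
...   | inj₁ u≡z = inj₂ u≡z
...   | inj₂ u∈∅ = ⊥-elim (∉⊥ u∈∅)

private
  swap-+ : ∀ a b c → a + (b + c) ≡ b + (a + c)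
  swap-+ a b c = trans (≡-sym (+-assoc a b c)) (trans (cong (_+ c) (+-comm a b)) (+-assoc b a c))

weightSum-delete : ∀ {n} (w : Fin n → ℕ) (D : Subset n) {i : Fin n} → i ∈ D
                 → weightSum w D ≡ w i + weightSum w (D [ i ]≔ false)
weightSum-delete w (true ∷ D) here = refl
weightSum-delete w (true ∷ D) {fsuc i} (there i∈D) =
  trans (cong (w fzero +_) (weightSum-delete (λ j → w (fsuc j)) D i∈D))
        (swap-+ (w fzero) (w (fsuc i)) (weightSum (λ j → w (fsuc j)) (D [ i ]≔ false)))
weightSum-delete w (false ∷ D) (there i∈D) = weightSum-delete (λ j → w (fsuc j)) D i∈D

weightSum-insert : ∀ {n} (w : Fin n → ℕ) (D : Subset n) {i : Fin n} → i ∉ D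
                 → weightSum w (D [ i ]≔ true) ≡ w i + weightSum w D
weightSum-insert w D {i} i∉D =
  trans (weightSum-delete w (D [ i ]≔ true) (∈-insert D i)) (cong (λ E → w i + weightSum w E) restore)
  where
  lookup-false : lookup D i ≡ false
  lookup-false with lookup D i in eq
  ... | true  = ⊥-elim (i∉D (lookup⇒[]= i D eq))
  ... | false = refl
  restore : (D [ i ]≔ true) [ i ]≔ false ≡ D
  restore = trans ([]≔-idempotent D i) (subst (λ b → D [ i ]≔ b ≡ D) lookup-false ([]≔-lookup D i))

weightSum-exchange : ∀ {n} (w : Fin n → ℕ) (S : Subset n) {a b : Fin n} → a ∈ S → b ∉ S → w b ≡ w a
                   → weightSum w ((S [ a ]≔ false) [ b ]≔ true) ≡ weightSum w S
weightSum-exchange w S {a} {b} a∈S b∉S wb≡wa = begin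
  weightSum w ((S [ a ]≔ false) [ b ]≔ true) ≡⟨ weightSum-insert w (S [ a ]≔ false) b∉S-a ⟩
  w b + weightSum w (S [ a ]≔ false)         ≡⟨ cong (_+ weightSum w (S [ a ]≔ false)) wb≡wa ⟩
  w a + weightSum w (S [ a ]≔ false)         ≡⟨ ≡-sym (weightSum-delete w S a∈S) ⟩
  weightSum w S                              ∎
  where
  open ≡-Reasoning
  b∉S-a : b ∉ S [ a ]≔ false
  b∉S-a b∈ with b ≟ a
  ... | yes refl = ∉-delete S a b∈
  ... | no  b≢a  = b∉S (∈-update⁻ S false b≢a b∈)

¬¬-∀-Fin : ∀ n {P : Fin n → Set} → (∀ i → ¬ ¬ P i) → ¬ ¬ (∀ i → P i)
¬¬-∀-Fin zero    h k = k (λ ())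
¬¬-∀-Fin (suc n) h k =
  h fzero λ p₀ → ¬¬-∀-Fin n (λ i → h (fsuc i)) λ ps →
    k λ { fzero → p₀ ; (fsuc i) → ps i }

-- Adjacency is decidable; needed to build maximal independent sets greedily.
AdjDecidable : ∀ {n} → Graph n → Set
AdjDecidable G = ∀ u v → Dec (Adj G u v)

¬¬-adjDecidable : ∀ {n} (G : Graph n) → ¬ ¬ AdjDecidable G
¬¬-adjDecidable {n} G =
  ¬¬-∀-Fin n λ u → ¬¬-∀-Fin n λ v → ¬¬-excluded-middle

module _ {n} (G : Graph n) where

  Independent : Subset n → Set
  Independent S = ∀ {u v} → u ∈ S → v ∈ S → ¬ Adj G u v

  Maximal : Subset n → Set
  Maximal S = ∀ v → v ∉ S → ∃ λ u → u ∈ S × Adj G v u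

  Candidate : Subset n → Fin n → Set
  Candidate S v = v ∉ S × ¬ (∃ λ u → u ∈ S × Adj G v u)

  independent-insert : ∀ {S v} → Candidate S v → Independent S → Independent (S [ v ]≔ true)
  independent-insert {S} {v} (_ , no-nbr) indS {u} {u′} u∈ u′∈
    with ∈-insert⁻ S u∈ | ∈-insert⁻ S u′∈
  ... | inj₁ refl | inj₁ refl = Graph.irrefl G
  ... | inj₁ refl | inj₂ u′∈S = λ adj → no-nbr (u′ , u′∈S , adj)
  ... | inj₂ u∈S  | inj₁ refl = λ adj → no-nbr (u , u∈S , Graph.sym G adj)
  ... | inj₂ u∈S  | inj₂ u′∈S = indS u∈S u′∈S

  independent-pair : ∀ {a z} → ¬ Adj G a z → Independent (pair a z)
  independent-pair ¬az u∈ v∈ with pair-members u∈ | pair-members v∈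
  ... | inj₁ refl | inj₁ refl = Graph.irrefl G
  ... | inj₁ refl | inj₂ refl = ¬az
  ... | inj₂ refl | inj₁ refl = λ za → ¬az (Graph.sym G za)
  ... | inj₂ refl | inj₂ refl = Graph.irrefl G

  exchange-undominated : ∀ {S a b} → Independent S → a ∈ S → a ≢ b → ¬ Adj G a b
                       → ¬ Dominated G ((S [ a ]≔ false) [ b ]≔ true) a
  exchange-undominated {S} {a} indS a∈S a≢b ¬ab (inj₁ a∈S′) =
    ∉-delete S a (∈-update⁻ _ true a≢b a∈S′)
  exchange-undominated {S} {a} indS a∈S a≢b ¬ab (inj₂ (u , u∈S′ , au)) with ∈-insert⁻ _ u∈S′
  ... | inj₁ refl = ¬ab au
  ... | inj₂ u∈S-a with u ≟ a
  ...   | yes refl = Graph.irrefl G au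
  ...   | no  u≢a  = indS a∈S (∈-update⁻ S false u≢a u∈S-a) au

  maximalIndependent⇒mds : ∀ {S} → Independent S → Maximal S → MinimalDominating G S
  maximalIndependent⇒mds {S} indS maxS = dominating , minimal
    where
    dominating : Dominating G S
    dominating v with v ∈? S
    ... | yes v∈S = inj₁ v∈S
    ... | no  v∉S = inj₂ (maxS v v∉S)
    -- Dropping a vertex v ∈ S leaves v undominated, as S is independent.
    minimal : ∀ D → D ⊂ S → ¬ Dominating G D
    minimal D (D⊆S , v , v∈S , v∉D) domD with domD v
    ... | inj₁ v∈D = v∉D v∈D
    ... | inj₂ (u , u∈D , adj) = indS v∈S (D⊆S u∈D) adj

  module _ (dec : AdjDecidable G) where

    candidate? : ∀ S v → Dec (Candidate S v)
    candidate? S v = ¬? (v ∈? S) ×-dec ¬? (any? λ u → (u ∈? S) ×-dec dec v u)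

    -- Greedy extension: add candidates until none is left.  The fuel k
    -- bounds the number of additions, since |S| grows and stays ≤ n.
    extend : ∀ k S → n ≤ k + ∣ S ∣ → Independent S
           → ∃ λ T → S ⊆ T × Independent T × Maximal T
    extend k S bound indS with any? (candidate? S)
    ... | no none = S , (λ s → s) , indS , maximal
      where
      maximal : Maximal S
      maximal v v∉S with any? (λ u → (u ∈? S) ×-dec dec v u)
      ... | yes nbr = nbr
      ... | no  nbr = ⊥-elim (none (v , v∉S , nbr))
    extend zero S bound indS | yes (v , v∉S , _) =
      ⊥-elim (≤⇒≯ (≤-trans (∣p∣≤n (S [ v ]≔ true)) bound) (p⊂q⇒∣p∣<∣q∣ (⊂-insert S v∉S)))
    extend (suc k) S bound indS | yes (v , cand@(v∉S , _))
      with extend k (S [ v ]≔ true) bound′ (independent-insert cand indS)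
      where
      bound′ : n ≤ k + ∣ S [ v ]≔ true ∣
      bound′ = ≤-trans bound (subst (_≤ k + ∣ S [ v ]≔ true ∣) (+-suc k ∣ S ∣)
                 (+-monoʳ-≤ k (p⊂q⇒∣p∣<∣q∣ (⊂-insert S v∉S))))
    ... | T , S′⊆T , indT , maxT = T , (λ s → S′⊆T (proj₁ (⊂-insert S v∉S) s)) , indT , maxT

    maximalIndependentExtension : ∀ S → Independent S
                                → ∃ λ T → S ⊆ T × Independent T × Maximal T
    maximalIndependentExtension S = extend n S (m≤m+n n ∣ S ∣)

    Distinguishes : Fin n → Fin n → Fin n → Set
    Distinguishes x y z = Adj G x z × ¬ Adj G y z

    distinguishingVertex : ∀ {x y} → ¬ Twins G x y
                         → ∃ λ z → Distinguishes x y z ⊎ Distinguishes y x z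
    distinguishingVertex {x} {y} ¬twins with any? (λ z → distinguishes? x y z ⊎-dec distinguishes? y x z)
      where
      distinguishes? : ∀ x y z → Dec (Distinguishes x y z)
      distinguishes? x y z = dec x z ×-dec ¬? (dec y z)
    ... | yes found = found
    ... | no  none  = ⊥-elim (¬twins twins)
      where
      twins : Twins G x y
      twins z _ _ = x→y , y→x
        where
        x→y : Adj G x z → Adj G y z
        x→y xz with dec y z
        ... | yes yz = yz
        ... | no ¬yz = ⊥-elim (none (z , inj₁ (xz , ¬yz)))
        y→x : Adj G y z → Adj G x z
        y→x yz with dec x z
        ... | yes xz = xz
        ... | no ¬xz = ⊥-elim (none (z , inj₂ (yz , ¬xz)))

    exchange : ∀ {w t} → EquidominatingStructure G w t
             → ∀ {a b z} → ¬ Adj G a b → Adj G b z → ¬ Adj G a z → w a ≢ w b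
    exchange {w} {t} E {a} {b} {z} ¬ab bz ¬az wa≡wb
      with maximalIndependentExtension (pair a z) (independent-pair ¬az)
    ... | S , pair⊆S , indS , maxS =
      exchange-undominated indS a∈S a≢b ¬ab (dominating-S′ a)
      where
      a≢b : a ≢ b
      a≢b refl = ¬az bz
      a∈S : a ∈ S
      a∈S = pair⊆S (pair-∋ˡ a z)
      -- b is adjacent to z ∈ S, so b ∉ S.
      b∉S : b ∉ S
      b∉S b∈S = indS b∈S (pair⊆S (pair-∋ʳ a z)) bz
      -- S is an mds, and exchanging a for b keeps the weight t, so the
      -- result is again an mds, in particular dominating.
      weight-S′ : weightSum w ((S [ a ]≔ false) [ b ]≔ true) ≡ t
      weight-S′ = trans (weightSum-exchange w S a∈S b∉S (≡-sym wa≡wb))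
        (proj₁ (EquidominatingStructure.char E S) (maximalIndependent⇒mds indS maxS))
      dominating-S′ : Dominating G ((S [ a ]≔ false) [ b ]≔ true)
      dominating-S′ = proj₁ (proj₂ (EquidominatingStructure.char E _) weight-S′)

lemma3p6 : ∀ {n} (G : Graph n) (w : Fin n → ℕ) (t : ℕ)
    → EquidominatingStructure G w t
    → (x y : Fin n)
    → ¬ Twins G x y
    → DistGe G x y 2
    → w x ≢ w y
lemma3p6 G w t E x y ¬twins dist≥2 wx≡wy = ¬¬-adjDecidable G contradiction
  where
  ¬xy : ¬ Adj G x y
  ¬xy xy = dist≥2 1 (s≤s (s≤s z≤n)) (step xy here)
  contradiction : AdjDecidable G → ⊥
  contradiction dec with distinguishingVertex G dec ¬twins
  ... | z , inj₁ (xz , ¬yz) = exchange G dec E (λ yx → ¬xy (Graph.sym G yx)) xz ¬yz (≡-sym wx≡wy)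
  ... | z , inj₂ (yz , ¬xz) = exchange G dec E ¬xy yz ¬xz wx≡wy
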